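{- Let $T$ be a consistent theory and let $\theta,\phi,\psi$ be formulas such that $T\vdash\lnot(\theta\to\lnot(\phi\,\mathtt u\,\psi))$. Then $T\cup\{\lnot(\theta\to\lnot\psi)\}$ is consistent, or there exists a nonnegative integer $m$ such that $T\cup\left\{\lnot\left(\theta\to\bigvee_{k=0}^m[1]^k(\lnot\phi\lor\psi)\lor[1]^{m+1}\lnot\psi\right)\right\}$ is consistent.
   Context: Let $Var=\{p_n : n\in\omega\}$. Formulas are built from $Var$ using unary $\lnot$, $[1]$, $[\omega]$ and binary $\land$, $\mathtt u$, $\mathtt U$; $\lor,\to,\leftrightarrow$ are defined as usual; $\mathtt f\phi:=(\phi\to\phi)\,\mathtt u\,\phi$, $\mathtt g\phi:=\lnot\mathtt f\lnot\phi$; $[a]^0\phi=\phi$, $[a]^{n+1}\phi=[a][a]^n\phi$ for $a\in\{1,\omega\}$. A theory is a nonempty set of formulas. Axioms are all instances of: A1 tautology instances; A2 $[1][\omega]\phi\leftrightarrow[\omega]\phi$; A3 $\lnot[a]\phi\leftrightarrow[a]\lnot\phi$, $a\in\{1,\omega\}$; A4 $[a](\phi*\psi)\leftrightarrow([a]\phi*[a]\psi)$ for $a\in\{1,\omega\}$, $*\in\{\land,\lor,\to,\leftrightarrow\}$; A5 $\psi\to(\phi\,\mathtt u\,\psi)$; A6 $\phi\,\mathtt u\,\psi\to\phi\,\mathtt U\,\psi$; A7 $\left(\bigwedge_{k=0}^n[1]^k(\phi\land\lnot\psi)\land[1]^{n+1}\psi\right)\to\phi\,\mathtt u\,\psi$;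 A8 $\left(\bigwedge_{k=0}^n[\omega]^k\mathtt g(\phi\land\lnot\psi)\land[\omega]^{n+1}(\phi\,\mathtt u\,\psi)\right)\to\phi\,\mathtt U\,\psi$ (for all $n\in\omega$). Rules: R1 modus ponens; R2 necessitation: from $\phi$ infer $[a]\phi$, $a\in\{1,\omega\}$; R3: from $\theta\to\lnot\psi$ and all $\theta\to\bigvee_{k=0}^n[1]^k(\lnot\phi\lor\psi)\lor[1]^{n+1}\lnot\psi$ ($n\in\omega$) infer $\theta\to\lnot(\phi\,\mathtt u\,\psi)$; R4: from $\theta\to\lnot(\phi\,\mathtt u\,\psi)$ and all $\theta\to\bigvee_{k=0}^n[\omega]^k\lnot\mathtt g(\phi\land\lnot\psi)\lor[\omega]^{n+1}\lnot(\phi\,\mathtt u\,\psi)$ ($n\in\omega$) infer $\theta\to\lnot(\phi\,\mathtt U\,\psi)$. $T\vdash\phi$ iff there is a sequence of formulas of order type $\alpha+1$ for some countable ordinal $\alpha$ ending in $\phi$, each member being an axiom, an element of $T$, or obtained from earlier members by a rule, with necessitation applied only to theorems (formulas derivable in this way from the empty set). $T$ is consistent iff there is no formula $\chi$ with both $T\vdash\chi$ and $T\vdash\lnot\chi$. -}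

module Defs where

open import Level using (0ℓ)
open import Data.Nat using (ℕ; zero; suc)
open import Data.Bool using (Bool; true; false; not; _∧_)
open import Data.Empty using (⊥)
open import Data.Sum using (_⊎_)
open import Data.Product using (Σ; _×_)
open import Relation.Binary.PropositionalEquality using (_≡_)
open import Relation.Nullary using (¬_)

data Mod : Set where
  one omega : Mod

data Formula : Set where
  var  : ℕ → Formula
  ~_   : Formula → Formula
  [_]_ : Mod → Formula → Formula
  _∧'_ : Formula → Formula → Formula
  _u_  : Formula → Formula → Formula
  _U_  : Formula → Formula → Formula

infix  9 ~_
infix  9 [_]_
infixl 7 _∧'_
infixl 6 _∨'_
infixr 5 _⇒_
infix  4 _⇔_
infix  8 _u_ _U_

_∨'_ : Formula → Formula → Formula
φ ∨' ψ = ~ (~ φ ∧' ~ ψ)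

_⇒_ : Formula → Formula → Formula
φ ⇒ ψ = ~ (φ ∧' ~ ψ)

_⇔_ : Formula → Formula → Formula
φ ⇔ ψ = (φ ⇒ ψ) ∧' (ψ ⇒ φ)

fO : Formula → Formula
fO φ = (φ ⇒ φ) u φ

gO : Formula → Formula
gO φ = ~ fO (~ φ)

[_]^_$_ : Mod → ℕ → Formula → Formula
[ a ]^ zero  $ φ = φ
[ a ]^ suc n $ φ = [ a ] ([ a ]^ n $ φ)

bigAnd : (ℕ → Formula) → ℕ → Formula
bigAnd f zero    = f zero
bigAnd f (suc n) = bigAnd f n ∧' f (suc n)

bigOr : (ℕ → Formula) → ℕ → Formula
bigOr f zero    = f zero
bigOr f (suc n) = bigOr f n ∨' f (suc n)

data BinOp : Set where
  andOp orOp impOp iffOp : BinOp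

applyOp : BinOp → Formula → Formula → Formula
applyOp andOp φ ψ = φ ∧' ψ
applyOp orOp  φ ψ = φ ∨' ψ
applyOp impOp φ ψ = φ ⇒ ψ
applyOp iffOp φ ψ = φ ⇔ ψ

-- Tautology instances: propositional evaluation where every formula whose
-- main connective is not ¬ or ∧ is treated as a propositional atom.
eval : (Formula → Bool) → Formula → Bool
eval v (~ φ)    = not (eval v φ)
eval v (φ ∧' ψ) = eval v φ ∧ eval v ψ
eval v φ        = v φ

Tautology : Formula → Set
Tautology φ = (v : Formula → Bool) → eval v φ ≡ true

data Axiom : Formula → Set where
  A1 : ∀ {φ} → Tautology φ → Axiom φ
  A2 : ∀ φ → Axiom ([ one ] [ omega ] φ ⇔ [ omega ] φ)
  A3 : ∀ a φ → Axiom (~ [ a ] φ ⇔ [ a ] ~ φ)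
  A4 : ∀ a (op : BinOp) φ ψ →
       Axiom ([ a ] applyOp op φ ψ ⇔ applyOp op ([ a ] φ) ([ a ] ψ))
  A5 : ∀ φ ψ → Axiom (ψ ⇒ φ u ψ)
  A6 : ∀ φ ψ → Axiom (φ u ψ ⇒ φ U ψ)
  A7 : ∀ φ ψ n →
       Axiom ((bigAnd (λ k → [ one ]^ k $ (φ ∧' ~ ψ)) n
                ∧' [ one ]^ suc n $ ψ) ⇒ φ u ψ)
  A8 : ∀ φ ψ n →
       Axiom ((bigAnd (λ k → [ omega ]^ k $ gO (φ ∧' ~ ψ)) n
                ∧' [ omega ]^ suc n $ (φ u ψ)) ⇒ φ U ψ)

R3disj : Formula → Formula → ℕ → Formula
R3disj φ ψ n = bigOr (λ k → [ one ]^ k $ (~ φ ∨' ψ)) n ∨' [ one ]^ suc n $ (~ ψ)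

R4disj : Formula → Formula → ℕ → Formula
R4disj φ ψ n = bigOr (λ k → [ omega ]^ k $ (~ gO (φ ∧' ~ ψ))) n
               ∨' [ omega ]^ suc n $ (~ (φ u ψ))

FSet : Set₁
FSet = Formula → Set

∅ : FSet
∅ _ = ⊥

_∪｛_｝ : FSet → Formula → FSet
(T ∪｛ χ ｝) ψ = T ψ ⊎ ψ ≡ χ

IsTheory : FSet → Set
IsTheory T = Σ Formula T

-- Infinitary derivability: well-founded derivation trees (equivalently,
-- derivation sequences of countable successor-ordinal length).
-- Necessitation only applies to theorems (derivable from ∅).
infix 3 _⊢_
data _⊢_ : FSet → Formula → Set₁ where
  ax  : ∀ {T φ} → Axiom φ → T ⊢ φ
  hyp : ∀ {T φ} → T φ → T ⊢ φ
  mp  : ∀ {T φ ψ} → T ⊢ φ → T ⊢ (φ ⇒ ψ) → T ⊢ ψ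
  nec : ∀ {T φ} a → ∅ ⊢ φ → T ⊢ [ a ] φ
  R3  : ∀ {T} θ φ ψ → T ⊢ (θ ⇒ ~ ψ) → ((n : ℕ) → T ⊢ (θ ⇒ R3disj φ ψ n)) →
        T ⊢ (θ ⇒ ~ (φ u ψ))
  R4  : ∀ {T} θ φ ψ → T ⊢ (θ ⇒ ~ (φ u ψ)) → ((n : ℕ) → T ⊢ (θ ⇒ R4disj φ ψ n)) →
        T ⊢ (θ ⇒ ~ (φ U ψ))

Consistent : FSet → Set₁
Consistent T = ¬ (Σ Formula λ χ → (T ⊢ χ) × (T ⊢ ~ χ))

-- If both extensions were inconsistent, then by excluded middle and the
-- deduction theorem T would derive θ → ¬ψ and every θ → R3disj φ ψ m, so rule
-- R3 would give θ → ¬(φ u ψ), contradicting the hypothesis and the consistency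
-- of T.  The deduction theorem survives the infinitary rules because
-- necessitation only acts on theorems and R3, R4 already carry an arbitrary
-- antecedent θ, into which the new hypothesis can be absorbed as a conjunct.
module Submission where

open import Defs
open import Level using (suc; zero)
open import Axiom.ExcludedMiddle using (ExcludedMiddle)
open import Data.Nat using (ℕ)
open import Data.Sum using (_⊎_; inj₁; inj₂)
open import Data.Product using (Σ; _,_)
open import Data.Bool using (Bool; true; false; not; _∧_)
open import Data.Empty using (⊥-elim)
open import Relation.Nullary using (¬_; yes; no)
open import Relation.Nullary.Decidable using (decidable-stable)
open import Relation.Binary.PropositionalEquality using (_≡_; refl)

infixr 5 _→ᵇ_

-- eval v (φ ⇒ ψ) reduces to eval v φ →ᵇ eval v ψ.
_→ᵇ_ : Bool → Bool → Bool
x →ᵇ y = not (x ∧ not y)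

⇒-refl : ∀ a → Tautology (a ⇒ a)
⇒-refl a v = table (eval v a)
  where
  table : ∀ x → (x →ᵇ x) ≡ true
  table true  = refl
  table false = refl

⇒-const : ∀ a b → Tautology (a ⇒ b ⇒ a)
⇒-const a b v = table (eval v a) (eval v b)
  where
  table : ∀ x y → (x →ᵇ y →ᵇ x) ≡ true
  table true  true  = refl
  table true  false = refl
  table false true  = refl
  table false false = refl

⇒-distrib : ∀ a b c → Tautology ((a ⇒ b) ⇒ (a ⇒ b ⇒ c) ⇒ a ⇒ c)
⇒-distrib a b c v = table (eval v a) (eval v b) (eval v c)
  where
  table : ∀ x y z → ((x →ᵇ y) →ᵇ (x →ᵇ y →ᵇ z) →ᵇ x →ᵇ z) ≡ true
  table true  true  true  = refl
  table true  true  false = refl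
  table true  false true  = refl
  table true  false false = refl
  table false true  true  = refl
  table false true  false = refl
  table false false true  = refl
  table false false false = refl

uncurry-⇒ : ∀ a b c → Tautology ((a ⇒ b ⇒ c) ⇒ a ∧' b ⇒ c)
uncurry-⇒ a b c v = table (eval v a) (eval v b) (eval v c)
  where
  table : ∀ x y z → ((x →ᵇ y →ᵇ z) →ᵇ x ∧ y →ᵇ z) ≡ true
  table true  true  true  = refl
  table true  true  false = refl
  table true  false true  = refl
  table true  false false = refl
  table false true  true  = refl
  table false true  false = refl
  table false false true  = refl
  table false false false = refl

curry-⇒ : ∀ a b c → Tautology ((a ∧' b ⇒ c) ⇒ a ⇒ b ⇒ c)
curry-⇒ a b c v = table (eval v a) (eval v b) (eval v c)
  where
  table : ∀ x y z → ((x ∧ y →ᵇ z) →ᵇ x →ᵇ y →ᵇ z) ≡ true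
  table true  true  true  = refl
  table true  true  false = refl
  table true  false true  = refl
  table true  false false = refl
  table false true  true  = refl
  table false true  false = refl
  table false false true  = refl
  table false false false = refl

reductio : ∀ a c → Tautology ((~ a ⇒ c) ⇒ (~ a ⇒ ~ c) ⇒ a)
reductio a c v = table (eval v a) (eval v c)
  where
  table : ∀ x y → ((not x →ᵇ y) →ᵇ (not x →ᵇ not y) →ᵇ x) ≡ true
  table true  true  = refl
  table true  false = refl
  table false true  = refl
  table false false = refl

mp-taut : ∀ {T a b} → T ⊢ a → Tautology (a ⇒ b) → T ⊢ b
mp-taut ⊢a taut = mp ⊢a (ax (A1 taut))

mp-taut₂ : ∀ {T a b c} → T ⊢ a → T ⊢ b → Tautology (a ⇒ b ⇒ c) → T ⊢ c
mp-taut₂ ⊢a ⊢b taut = mp ⊢b (mp-taut ⊢a taut)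

⊢-weaken-⇒ : ∀ {T χ α} → T ⊢ α → T ⊢ (χ ⇒ α)
⊢-weaken-⇒ {χ = χ} {α} ⊢α = mp-taut ⊢α (⇒-const α χ)

deduction : ∀ {T χ α} → (T ∪｛ χ ｝) ⊢ α → T ⊢ (χ ⇒ α)
deduction (ax axiom)                 = ⊢-weaken-⇒ (ax axiom)
deduction (hyp (inj₁ α∈T))           = ⊢-weaken-⇒ (hyp α∈T)
deduction {χ = χ} (hyp (inj₂ refl))  = ax (A1 (⇒-refl χ))
deduction {χ = χ} (mp {φ = φ} {ψ} ⊢φ ⊢φ⇒ψ) =
  mp-taut₂ (deduction ⊢φ) (deduction ⊢φ⇒ψ) (⇒-distrib χ φ ψ)
deduction (nec a ⊢φ)                 = ⊢-weaken-⇒ (nec a ⊢φ)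
deduction {χ = χ} (R3 θ φ ψ ⊢first ⊢rest) =
  mp-taut (R3 (χ ∧' θ) φ ψ (mp-taut (deduction ⊢first) (uncurry-⇒ χ θ (~ ψ)))
             (λ n → mp-taut (deduction (⊢rest n)) (uncurry-⇒ χ θ (R3disj φ ψ n))))
          (curry-⇒ χ θ (~ (φ u ψ)))
deduction {χ = χ} (R4 θ φ ψ ⊢first ⊢rest) =
  mp-taut (R4 (χ ∧' θ) φ ψ (mp-taut (deduction ⊢first) (uncurry-⇒ χ θ (~ (φ u ψ))))
             (λ n → mp-taut (deduction (⊢rest n)) (uncurry-⇒ χ θ (R4disj φ ψ n))))
          (curry-⇒ χ θ (~ (φ U ψ)))

⊢-by-contradiction : ExcludedMiddle (suc zero) → ∀ {T χ} →
                     ¬ Consistent (T ∪｛ ~ χ ｝) → T ⊢ χ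
⊢-by-contradiction em {χ = χ} inconsistent
  with decidable-stable em inconsistent
... | γ , ⊢γ , ⊢¬γ = mp-taut₂ (deduction ⊢γ) (deduction ⊢¬γ) (reductio χ γ)

mainTheorem3 : ExcludedMiddle (suc zero) →
    (T : FSet) → IsTheory T → Consistent T →
    (θ φ ψ : Formula) → T ⊢ ~ (θ ⇒ ~ (φ u ψ)) →
    Consistent (T ∪｛ ~ (θ ⇒ ~ ψ) ｝)
    ⊎ Σ ℕ (λ m → Consistent (T ∪｛ ~ (θ ⇒ R3disj φ ψ m) ｝))
mainTheorem3 em T _ T-consistent θ φ ψ ⊢¬[θ⇒¬φuψ]
  with em {Consistent (T ∪｛ ~ (θ ⇒ ~ ψ) ｝)}
     | em {Σ ℕ (λ m → Consistent (T ∪｛ ~ (θ ⇒ R3disj φ ψ m) ｝))}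
... | yes consistent₀   | _                = inj₁ consistent₀
... | no _             | yes consistentₘ  = inj₂ consistentₘ
... | no inconsistent₀ | no inconsistentₘ =
  ⊥-elim (T-consistent (_ , ⊢θ⇒¬φuψ , ⊢¬[θ⇒¬φuψ]))
  where
  ⊢θ⇒¬φuψ : T ⊢ (θ ⇒ ~ (φ u ψ))
  ⊢θ⇒¬φuψ = R3 θ φ ψ (⊢-by-contradiction em inconsistent₀)
                     (λ m → ⊢-by-contradiction em (λ c → inconsistentₘ (m , c)))
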